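{- Let ${\cal M}$ be an orientably regular map on a compact oriented surface, let $G=\mathrm{Aut}^+{\cal M}$, and suppose $G$ acts primitively on the vertices of ${\cal M}$. Let $N$ be the kernel of this action. If $N$ is not contained in the centre of $G$, then ${\cal M}\cong {\cal D}_k(u)$ for some $k$ and some $u\in\mathbb{Z}_k$ with $u^2\equiv 1\pmod k$ and $u\not\equiv 1\pmod k$.
   Context: A map is orientably regular if its group $\mathrm{Aut}^+{\cal M}$ of orientation-preserving automorphisms acts transitively on its arcs. Orientably regular maps ${\cal M}$ with $\mathrm{Aut}^+{\cal M}\cong G$ correspond (up to the action of $\mathrm{Aut}\,G$) to generating pairs $x,y$ of $G$ with $y^2=1$, where $x$ is the rotation about a vertex (sending each incident edge to the next in the local orientation) and $y$ is the half-turn reversing an incident edge; vertices correspond to cosets of $\langle x\rangle$. For $k\ge 1$ and $u$ with $u^2\equiv 1\pmod k$, the dipole map ${\cal D}_k(u)$ is the orientably regular map associated with the group $\langle x,y\mid x^k=y^2=1,\ x^y=x^u\rangle$ of order $2k$ and generators $x,y$; it has two vertices of valency $k$ joined by $k$ edges. -}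

module Defs where

open import Level using (Level; _⊔_; suc)
open import Algebra.Bundles using (Group)
open import Data.Nat as ℕ using (ℕ; zero)
open import Data.Fin using (Fin)
open import Data.Bool using (Bool; true; false; if_then_else_; _xor_)
open import Data.Integer as ℤ using (ℤ; +_)
open import Data.Integer.Divisibility as ℤD using ()
open import Data.Product using (Σ; ∃; _×_; _,_)
open import Data.Sum using (_⊎_)
open import Relation.Nullary using (¬_)
open import Relation.Binary.PropositionalEquality as ≡ using (_≡_)
open import Function.Bundles using (Inverse; _⇔_)

module _ {c ℓ : Level} (G : Group c ℓ) where
  open Group G

  FiniteGroup : Set (c ⊔ ℓ)
  FiniteGroup = ∃ λ (n : ℕ) → Inverse (≡.setoid (Fin n)) setoid

  pow : Carrier → ℕ → Carrier
  pow g zero      = ε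
  pow g (ℕ.suc n) = g ∙ pow g n

  InCyclic : Carrier → Carrier → Set ℓ
  InCyclic g h = ∃ λ (n : ℕ) → (h ≈ pow g n) ⊎ (h ≈ (pow g n) ⁻¹)

  data InGenerated (x y : Carrier) : Carrier → Set (c ⊔ ℓ) where
    gen-x : InGenerated x y x
    gen-y : InGenerated x y y
    gen-ε : InGenerated x y ε
    gen-∙ : ∀ {a b} → InGenerated x y a → InGenerated x y b → InGenerated x y (a ∙ b)
    gen-⁻¹ : ∀ {a} → InGenerated x y a → InGenerated x y (a ⁻¹)
    gen-≈ : ∀ {a b} → a ≈ b → InGenerated x y a → InGenerated x y b

  Generates : Carrier → Carrier → Set (c ⊔ ℓ)
  Generates x y = ∀ g → InGenerated x y g

  -- Vertices of the map with rotation x: left cosets g⟨x⟩, represented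
  -- by elements g, with  g ~ h  iff  g⁻¹h ∈ ⟨x⟩  (same coset).
  SameVertex : Carrier → Carrier → Carrier → Set ℓ
  SameVertex x g h = InCyclic x (g ⁻¹ ∙ h)

  -- G acts on vertices by left multiplication:  g · (h⟨x⟩) = (g h)⟨x⟩.

  IsVertexSet : Carrier → (Carrier → Set (c ⊔ ℓ)) → Set (c ⊔ ℓ)
  IsVertexSet x B = ∀ a b → SameVertex x a b → B a → B b

  -- block of imprimitivity: for every g, if gB ∩ B ≠ ∅ then gB = B
  -- (w ∈ gB  iff  g⁻¹w ∈ B)
  IsBlock : Carrier → (Carrier → Set (c ⊔ ℓ)) → Set (c ⊔ ℓ)
  IsBlock x B = IsVertexSet x B ×
    (∀ g → (∃ λ w → B (g ⁻¹ ∙ w) × B w) → ∀ w → B (g ⁻¹ ∙ w) ⇔ B w)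

  -- trivial block: empty or a singleton (all members are the same vertex),
  -- or the whole vertex set
  TrivialBlock : Carrier → (Carrier → Set (c ⊔ ℓ)) → Set (c ⊔ ℓ)
  TrivialBlock x B = (∀ a b → B a → B b → SameVertex x a b) ⊎ (∀ a → B a)

  PrimitiveOnVertices : Carrier → Set (suc (c ⊔ ℓ))
  PrimitiveOnVertices x =
    (∀ a b → ∃ λ g → SameVertex x (g ∙ a) b) ×
    (∀ (B : Carrier → Set (c ⊔ ℓ)) → IsBlock x B → TrivialBlock x B)

  InKernel : Carrier → Carrier → Set (c ⊔ ℓ)
  InKernel x g = ∀ h → SameVertex x (g ∙ h) h

  InCentre : Carrier → Set (c ⊔ ℓ)
  InCentre g = ∀ h → (g ∙ h) ≈ (h ∙ g)

-- The group of the dipole map D_k(u):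
--   ⟨ x, y | x^k = y^2 = 1, x^y = x^u ⟩  ≅  ℤ_k ⋊ ℤ_2,
-- modelled by normal forms  x^a y^s  (a ∈ ℤ mod k, s ∈ Bool),
-- with generators x = (1,false), y = (0,true).
-- Since y x y = x^u, the product is  x^a y^s · x^b y^t = x^(a + u^s b) y^(s xor t).

module Dipole (k : ℕ) (u : ℤ) where

  Elt : Set
  Elt = ℤ × Bool

  _≈D_ : Elt → Elt → Set
  (a , s) ≈D (b , t) = (s ≡ t) × ((+ k) ℤD.∣ (a ℤ.- b))

  _·D_ : Elt → Elt → Elt
  (a , s) ·D (b , t) = (a ℤ.+ (if s then u ℤ.* b else b)) , (s xor t)

  xD : Elt
  xD = (+ 1) , false

  yD : Elt
  yD = (+ 0) , true

-- Isomorphism of orientably regular maps (G, x, y) ≅ D_k(u):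
-- a group isomorphism G → Aut⁺ D_k(u) sending x ↦ x and y ↦ y.

module _ {c ℓ : Level} (G : Group c ℓ) where
  open Group G

  IsoToDipole : Carrier → Carrier → ℕ → ℤ → Set (c ⊔ ℓ)
  IsoToDipole x y k u = ∃ λ (φ : Carrier → Elt) →
      (∀ g h → g ≈ h → φ g ≈D φ h)
    × (∀ g h → φ g ≈D φ h → g ≈ h)
    × (∀ e → ∃ λ g → φ g ≈D e)
    × (∀ g h → φ (g ∙ h) ≈D (φ g ·D φ h))
    × (φ x ≈D xD)
    × (φ y ≈D yD)
    where open Dipole k u

-- The kernel N of the action on vertices fixes the vertex ⟨x⟩, so N ⊆ ⟨x⟩ and ⟨x⟩ lies in the
-- centraliser C of N. A subgroup containing the vertex stabiliser ⟨x⟩ is a block, so by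
-- primitivity C is ⟨x⟩ or G; the latter would make N central. Hence C = ⟨x⟩, and as N is
-- normal so is C: thus x^y = x^u. Every element is then a normal form x^a y^s, unique modulo the
-- order k of x because y ∉ ⟨x⟩, which identifies G with D_k(u). Finally u² ≡ 1 since y² = 1,
-- and u ≢ 1 since otherwise G would be abelian and N central.
module Submission where

open import Defs
open import Level using (Level)
open import Algebra.Bundles using (Group)
import Algebra.Properties.Group as GroupProperties
open import Tactic.MonoidSolver using (solve)
open import Data.Bool using (Bool; true; false; if_then_else_; _xor_)
open import Data.Empty using (⊥-elim)
import Data.Fin as Fin
import Data.Fin.Properties as Fin
open import Data.Integer using (ℤ; +_; _*_; _-_)
import Data.Integer as ℤ
import Data.Integer.Properties as ℤ
import Data.Integer.DivMod as ℤ
open import Data.Integer.Divisibility using (_∣_)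
import Data.Integer.Divisibility.Signed as Signed
open import Data.Integer.Tactic.RingSolver using (solve-∀)
open import Data.Nat as ℕ using (ℕ; zero; suc; _<_; _≤_; _∸_; _≥_; z≤n; s≤s)
import Data.Nat.Properties as ℕ
import Data.Nat.Divisibility as ℕ
import Data.Nat.DivMod as ℕ
open import Data.Nat.Induction using (<-wellFounded)
open import Induction.WellFounded using (Acc; acc)
open import Data.Product using (∃; ∃₂; _×_; _,_; proj₁; proj₂)
open import Data.Sum using (_⊎_; inj₁; inj₂; [_,_]′)
open import Function.Base using (_∘_)
open import Function.Bundles using (Inverse; Injection; _⇔_; mk⇔; Equivalence)
open import Function.Construct.Composition using (_⇔-∘_)
import Function.Construct.Symmetry as Symmetry
open import Function.Properties.Inverse using (Inverse⇒Injection)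
open import Relation.Nullary using (¬_; Dec; yes; no)
open import Relation.Nullary.Decidable using (map′)
open import Relation.Binary.PropositionalEquality as ≡ using (_≡_)

module _ {p} {P : ℕ → Set p} (P? : ∀ n → Dec (P n)) where

  leastWitness : ∀ {n} → P n → ∃ λ m → P m × (∀ {j} → j < m → ¬ P j)
  leastWitness {n} = go (<-wellFounded n)
    where
    go : ∀ {n} → Acc _<_ n → P n → ∃ λ m → P m × (∀ {j} → j < m → ¬ P j)
    go {n} (acc smaller) Pn with ℕ.anyUpTo? P? n
    ... | yes (j , j<n , Pj) = go (smaller j<n) Pj
    ... | no none            = n , Pn , λ j<n Pj → none (_ , j<n , Pj)

∣-telescope : ∀ {k i j l} → k ∣ (i - j) → k ∣ (j - l) → k ∣ (i - l)
∣-telescope {k} {i} {j} {l} k∣i-j k∣j-l =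
  Signed.∣⇒∣ᵤ (≡.subst (Signed._∣_ k) (ℤ.+-minus-telescope i j l)
    (Signed.∣m∣n⇒∣m+n (Signed.∣ᵤ⇒∣ {k} {i - j} k∣i-j) (Signed.∣ᵤ⇒∣ {k} {j - l} k∣j-l)))

n∣[m%ℕn]-m : ∀ m n .{{_ : ℕ.NonZero n}} → (+ n) ∣ (+ (m ℤ.%ℕ n) - m)
n∣[m%ℕn]-m m n = Signed.∣⇒∣ᵤ (≡.subst (Signed._∣_ (+ n)) (≡.sym r-m≡-q*n)
  (Signed.∣m⇒∣-m (Signed.∣n⇒∣m*n q Signed.∣-refl)))
  where
  r = + (m ℤ.%ℕ n)
  q = m ℤ./ℕ n
  i-[i+j]≡-j : ∀ i j → i - (i ℤ.+ j) ≡ ℤ.- j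
  i-[i+j]≡-j = solve-∀
  r-m≡-q*n : r - m ≡ ℤ.- (q * + n)
  r-m≡-q*n = ≡.trans (≡.cong (r -_) (ℤ.a≡a%ℕn+[a/ℕn]*n m n)) (i-[i+j]≡-j r (q * + n))

module GroupLemmas {c ℓ} (G : Group c ℓ) where
  open Group G hiding (_-_)
  open GroupProperties G
  open import Relation.Binary.Reasoning.Setoid setoid

  Commute : Carrier → Carrier → Set ℓ
  Commute a b = a ∙ b ≈ b ∙ a

  commute-respˡ-≈ : ∀ {a b z} → a ≈ b → Commute a z → Commute b z
  commute-respˡ-≈ {a} {b} {z} a≈b az = begin
    b ∙ z ≈⟨ ∙-congʳ a≈b ⟨
    a ∙ z ≈⟨ az ⟩
    z ∙ a ≈⟨ ∙-congˡ a≈b ⟩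
    z ∙ b ∎

  commute-respʳ-≈ : ∀ {a b z} → a ≈ b → Commute z a → Commute z b
  commute-respʳ-≈ a≈b za = sym (commute-respˡ-≈ a≈b (sym za))

  ε-commute : ∀ {z} → Commute ε z
  ε-commute {z} = trans (identityˡ z) (sym (identityʳ z))

  ∙-commute : ∀ {a b z} → Commute a z → Commute b z → Commute (a ∙ b) z
  ∙-commute {a} {b} {z} az bz = begin
    a ∙ b ∙ z   ≈⟨ assoc a b z ⟩
    a ∙ (b ∙ z) ≈⟨ ∙-congˡ bz ⟩
    a ∙ (z ∙ b) ≈⟨ assoc a z b ⟨
    a ∙ z ∙ b   ≈⟨ ∙-congʳ az ⟩
    z ∙ a ∙ b   ≈⟨ assoc z a b ⟩
    z ∙ (a ∙ b) ∎

  ⁻¹-commute : ∀ {a z} → Commute a z → Commute (a ⁻¹) z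
  ⁻¹-commute {a} {z} az = begin
    a ⁻¹ ∙ z                ≈⟨ identityʳ _ ⟨
    a ⁻¹ ∙ z ∙ ε            ≈⟨ ∙-congˡ (inverseʳ a) ⟨
    a ⁻¹ ∙ z ∙ (a ∙ a ⁻¹)   ≈⟨ solve monoid ⟩
    a ⁻¹ ∙ (z ∙ a) ∙ a ⁻¹   ≈⟨ ∙-congʳ (∙-congˡ az) ⟨
    a ⁻¹ ∙ (a ∙ z) ∙ a ⁻¹   ≈⟨ solve monoid ⟩
    a ⁻¹ ∙ a ∙ z ∙ a ⁻¹     ≈⟨ ∙-congʳ (∙-congʳ (inverseˡ a)) ⟩
    ε ∙ z ∙ a ⁻¹            ≈⟨ ∙-congʳ (identityˡ z) ⟩
    z ∙ a ⁻¹                ∎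

  record IsSubgroup {p} (H : Carrier → Set p) : Set (c Level.⊔ ℓ Level.⊔ p) where
    field
      ∈-resp-≈ : ∀ {a b} → a ≈ b → H a → H b
      ε∈       : H ε
      ∙∈       : ∀ {a b} → H a → H b → H (a ∙ b)
      ⁻¹∈      : ∀ {a} → H a → H (a ⁻¹)

  Centralises : ∀ {p} → (Carrier → Set p) → Carrier → Set (c Level.⊔ ℓ Level.⊔ p)
  Centralises S a = ∀ n → S n → Commute a n

  centraliser-isSubgroup : ∀ {p} (S : Carrier → Set p) → IsSubgroup (Centralises S)
  centraliser-isSubgroup S = record
    { ∈-resp-≈ = λ a≈b a∈C n n∈S → commute-respˡ-≈ a≈b (a∈C n n∈S)
    ; ε∈       = λ _ _ → ε-commute
    ; ∙∈       = λ a∈C b∈C n n∈S → ∙-commute (a∈C n n∈S) (b∈C n n∈S)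
    ; ⁻¹∈      = λ a∈C n n∈S → ⁻¹-commute (a∈C n n∈S)
    }

  generated⊆subgroup : ∀ {p} {H : Carrier → Set p} {x y} →
    IsSubgroup H → H x → H y → ∀ {g} → InGenerated G x y g → H g
  generated⊆subgroup {H = H} {x} {y} H-subgroup x∈H y∈H = go
    where
    open IsSubgroup H-subgroup
    go : ∀ {g} → InGenerated G x y g → H g
    go gen-x         = x∈H
    go gen-y         = y∈H
    go gen-ε         = ε∈
    go (gen-∙ a b)   = ∙∈ (go a) (go b)
    go (gen-⁻¹ a)    = ⁻¹∈ (go a)
    go (gen-≈ a≈b a) = ∈-resp-≈ a≈b (go a)

  commute-generators⇒commute : ∀ {x y z} → Generates G x y →
    Commute x z → Commute y z → ∀ g → Commute g z
  commute-generators⇒commute {z = z} generates xz yz g =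
    generated⊆subgroup (centraliser-isSubgroup (_≡ z))
      (λ { _ ≡.refl → xz }) (λ { _ ≡.refl → yz }) (generates g) z ≡.refl

  commuting-generators⇒commutative : ∀ {x y} → Generates G x y → Commute x y →
    ∀ g h → Commute g h
  commuting-generators⇒commutative {x} {y} generates xy g h =
    sym (commute-generators⇒commute generates (sym (g-commutes-x g)) (sym (g-commutes-y g)) h)
    where
    g-commutes-x : ∀ g → Commute g x
    g-commutes-x = commute-generators⇒commute generates refl (sym xy)

    g-commutes-y : ∀ g → Commute g y
    g-commutes-y = commute-generators⇒commute generates xy refl

  pow-+ : ∀ g m n → pow G g (m ℕ.+ n) ≈ pow G g m ∙ pow G g n
  pow-+ g zero    n = sym (identityˡ _)
  pow-+ g (suc m) n = trans (∙-congˡ (pow-+ g m n)) (sym (assoc _ _ _))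

  pow-commute : ∀ g m n → Commute (pow G g m) (pow G g n)
  pow-commute g m n = begin
    pow G g m ∙ pow G g n ≈⟨ pow-+ g m n ⟨
    pow G g (m ℕ.+ n)     ≡⟨ ≡.cong (pow G g) (ℕ.+-comm m n) ⟩
    pow G g (n ℕ.+ m)     ≈⟨ pow-+ g n m ⟩
    pow G g n ∙ pow G g m ∎

  pow-+≈⇔≈ε : ∀ g m d → pow G g (m ℕ.+ d) ≈ pow G g m ⇔ pow G g d ≈ ε
  pow-+≈⇔≈ε g m d = mk⇔
    (λ gᵐ⁺ᵈ≈gᵐ → ∙-cancelˡ (pow G g m) _ _ (trans (sym (pow-+ g m d)) (trans gᵐ⁺ᵈ≈gᵐ (sym (identityʳ _)))))
    (λ gᵈ≈ε → trans (pow-+ g m d) (trans (∙-congˡ gᵈ≈ε) (identityʳ _)))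

  conj : Carrier → Carrier → Carrier
  conj g a = g ⁻¹ ∙ a ∙ g

  conj-cong : ∀ {g h a b} → g ≈ h → a ≈ b → conj g a ≈ conj h b
  conj-cong g≈h a≈b = ∙-cong (∙-cong (⁻¹-cong g≈h) a≈b) g≈h

  conj-ε : ∀ g → conj g ε ≈ ε
  conj-ε g = trans (∙-congʳ (identityʳ (g ⁻¹))) (inverseˡ g)

  conj-∙ : ∀ g a b → conj g (a ∙ b) ≈ conj g a ∙ conj g b
  conj-∙ g a b = begin
    g ⁻¹ ∙ (a ∙ b) ∙ g              ≈⟨ solve monoid ⟩
    g ⁻¹ ∙ a ∙ ε ∙ b ∙ g            ≈⟨ ∙-congʳ (∙-congʳ (∙-congˡ (inverseʳ g))) ⟨
    g ⁻¹ ∙ a ∙ (g ∙ g ⁻¹) ∙ b ∙ g   ≈⟨ solve monoid ⟩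
    (g ⁻¹ ∙ a ∙ g) ∙ (g ⁻¹ ∙ b ∙ g) ∎

  conj-commute : ∀ g {a b} → Commute a b → Commute (conj g a) (conj g b)
  conj-commute g {a} {b} ab = begin
    conj g a ∙ conj g b ≈⟨ conj-∙ g a b ⟨
    conj g (a ∙ b)      ≈⟨ conj-cong refl ab ⟩
    conj g (b ∙ a)      ≈⟨ conj-∙ g b a ⟩
    conj g b ∙ conj g a ∎

  conj-conj⁻¹ : ∀ g a → conj g (conj (g ⁻¹) a) ≈ a
  conj-conj⁻¹ g a = begin
    g ⁻¹ ∙ (g ⁻¹ ⁻¹ ∙ a ∙ g ⁻¹) ∙ g ≈⟨ conj-cong refl (∙-congʳ (∙-congʳ (⁻¹-involutive g))) ⟩
    g ⁻¹ ∙ (g ∙ a ∙ g ⁻¹) ∙ g       ≈⟨ solve monoid ⟩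
    (g ⁻¹ ∙ g) ∙ a ∙ (g ⁻¹ ∙ g)     ≈⟨ ∙-cong (∙-congʳ (inverseˡ g)) (inverseˡ g) ⟩
    ε ∙ a ∙ ε                       ≈⟨ solve monoid ⟩
    a                               ∎

  ⁻¹∙≈conj∙⁻¹ : ∀ g a → g ⁻¹ ∙ a ≈ conj g a ∙ g ⁻¹
  ⁻¹∙≈conj∙⁻¹ g a = begin
    g ⁻¹ ∙ a              ≈⟨ identityʳ _ ⟨
    g ⁻¹ ∙ a ∙ ε          ≈⟨ ∙-congˡ (inverseʳ g) ⟨
    g ⁻¹ ∙ a ∙ (g ∙ g ⁻¹) ≈⟨ solve monoid ⟩
    g ⁻¹ ∙ a ∙ g ∙ g ⁻¹   ∎

  conj-fixed⇒commute : ∀ {g a} → conj g a ≈ a → Commute a g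
  conj-fixed⇒commute {g} {a} aᵍ≈a = begin
    a ∙ g              ≈⟨ identityˡ _ ⟨
    ε ∙ (a ∙ g)        ≈⟨ ∙-congʳ (inverseʳ g) ⟨
    g ∙ g ⁻¹ ∙ (a ∙ g) ≈⟨ solve monoid ⟩
    g ∙ (g ⁻¹ ∙ a ∙ g) ≈⟨ ∙-congˡ aᵍ≈a ⟩
    g ∙ a              ∎

module Order {c ℓ} (G : Group c ℓ) (finite : FiniteGroup G) (x : Group.Carrier G) where
  open Group G hiding (_-_)
  open GroupProperties G
  open GroupLemmas G
  open import Relation.Binary.Reasoning.Setoid setoid

  private
    enumeration : Inverse (≡.setoid (Fin.Fin (proj₁ finite))) setoid
    enumeration = proj₂ finite

    index : Carrier → Fin.Fin (proj₁ finite)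
    index = Inverse.from enumeration

    index-injective : ∀ {a b} → index a ≡ index b → a ≈ b
    index-injective = Injection.injective (Inverse⇒Injection (Symmetry.inverse enumeration))

    _≟_ : ∀ a b → Dec (a ≈ b)
    a ≟ b = map′ index-injective (Inverse.from-cong enumeration) (index a Fin.≟ index b)

  pow-periodic : ∃ λ d → pow G x (suc d) ≈ ε
  pow-periodic with Fin.pigeonhole (ℕ.n<1+n _) (λ i → index (pow G x (Fin.toℕ i)))
  ... | i , j , i<j , same = d , Equivalence.to (pow-+≈⇔≈ε x (Fin.toℕ i) (suc d)) (begin
    pow G x (Fin.toℕ i ℕ.+ suc d)
      ≡⟨ ≡.cong (pow G x) (≡.trans (ℕ.+-suc (Fin.toℕ i) d) (ℕ.m+[n∸m]≡n i<j)) ⟩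
    pow G x (Fin.toℕ j) ≈⟨ index-injective same ⟨
    pow G x (Fin.toℕ i) ∎)
    where
    d : ℕ
    d = Fin.toℕ j ∸ suc (Fin.toℕ i)

  private
    least : ∃ λ m → pow G x (suc m) ≈ ε × (∀ {j} → j < m → ¬ pow G x (suc j) ≈ ε)
    least = leastWitness (λ m → pow G x (suc m) ≟ ε) {proj₁ pow-periodic} (proj₂ pow-periodic)

  order : ℕ
  order = suc (proj₁ least)

  pow-order : pow G x order ≈ ε
  pow-order = proj₁ (proj₂ least)

  order-minimal : ∀ {r} → r < order → pow G x r ≈ ε → r ≡ 0
  order-minimal {zero}  _         _      = ≡.refl
  order-minimal {suc r} r+1<order xʳ⁺¹≈ε = ⊥-elim (proj₂ (proj₂ least) (ℕ.s≤s⁻¹ r+1<order) xʳ⁺¹≈ε)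

  pow-*order : ∀ q → pow G x (q ℕ.* order) ≈ ε
  pow-*order zero    = refl
  pow-*order (suc q) = begin
    pow G x (order ℕ.+ q ℕ.* order)       ≈⟨ pow-+ x order (q ℕ.* order) ⟩
    pow G x order ∙ pow G x (q ℕ.* order) ≈⟨ ∙-cong pow-order (pow-*order q) ⟩
    ε ∙ ε                                 ≈⟨ identityˡ ε ⟩
    ε                                     ∎

  pow≈ε⇒order∣ : ∀ n → pow G x n ≈ ε → order ℕ.∣ n
  pow≈ε⇒order∣ n xⁿ≈ε = ℕ.m%n≡0⇒n∣m n order (order-minimal (ℕ.m%n<n n order) (begin
    pow G x (n ℕ.% order)                                        ≈⟨ identityʳ _ ⟨
    pow G x (n ℕ.% order) ∙ ε                                    ≈⟨ ∙-congˡ (pow-*order (n ℕ./ order)) ⟨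
    pow G x (n ℕ.% order) ∙ pow G x (n ℕ./ order ℕ.* order)      ≈⟨ pow-+ x (n ℕ.% order) _ ⟨
    pow G x (n ℕ.% order ℕ.+ n ℕ./ order ℕ.* order)              ≡⟨ ≡.cong (pow G x) (ℕ.m≡m%n+[m/n]*n n order) ⟨
    pow G x n                                                    ≈⟨ xⁿ≈ε ⟩
    ε                                                            ∎))

  pow≈ε⇔order∣ : ∀ n → pow G x n ≈ ε ⇔ order ℕ.∣ n
  pow≈ε⇔order∣ n = mk⇔ (pow≈ε⇒order∣ n)
    λ { (ℕ.divides q n≡q*order) → trans (reflexive (≡.cong (pow G x) n≡q*order)) (pow-*order q) }

  pow≈pow⇔order∣∸ : ∀ {a b} → b ≤ a → pow G x a ≈ pow G x b ⇔ order ℕ.∣ a ∸ b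
  pow≈pow⇔order∣∸ {a} {b} b≤a =
    pow≈ε⇔order∣ (a ∸ b) ⇔-∘
    ≡.subst (λ n → pow G x n ≈ pow G x b ⇔ pow G x (a ∸ b) ≈ ε) (ℕ.m+[n∸m]≡n b≤a)
      (pow-+≈⇔≈ε x b (a ∸ b))

  pow≈pow⇔∣ : ∀ a b → pow G x a ≈ pow G x b ⇔ (+ order) ∣ (+ a - + b)
  pow≈pow⇔∣ a b with ℕ.≤-total b a
  ... | inj₁ b≤a = ≡.subst (λ n → pow G x a ≈ pow G x b ⇔ order ℕ.∣ n) (≡.sym ∣a-b∣≡a∸b)
    (pow≈pow⇔order∣∸ b≤a)
    where
    ∣a-b∣≡a∸b : ℤ.∣ + a - + b ∣ ≡ a ∸ b
    ∣a-b∣≡a∸b = ≡.cong ℤ.∣_∣ (≡.trans (ℤ.[+m]-[+n]≡m⊖n a b) (ℤ.⊖-≥ b≤a))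
  ... | inj₂ a≤b = ≡.subst (λ n → pow G x a ≈ pow G x b ⇔ order ℕ.∣ n) (≡.sym ∣a-b∣≡b∸a)
    (pow≈pow⇔order∣∸ a≤b ⇔-∘ mk⇔ sym sym)
    where
    ∣a-b∣≡b∸a : ℤ.∣ + a - + b ∣ ≡ b ∸ a
    ∣a-b∣≡b∸a = ≡.trans (≡.cong ℤ.∣_∣ (ℤ.[+m]-[+n]≡m⊖n a b)) (ℤ.∣⊖∣-≤ a≤b)

  pow-⁻¹ : ∀ m → pow G x m ⁻¹ ≈ pow G x (m ℕ.* ℕ.pred order)
  pow-⁻¹ m = sym (inverseʳ-unique (pow G x m) _ (begin
    pow G x m ∙ pow G x (m ℕ.* ℕ.pred order) ≈⟨ pow-+ x m _ ⟨
    pow G x (m ℕ.+ m ℕ.* ℕ.pred order)      ≡⟨ ≡.cong (pow G x) (ℕ.*-suc m _) ⟨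
    pow G x (m ℕ.* order)                   ≈⟨ pow-*order m ⟩
    ε                                       ∎))

  InCyclic⇒pow : ∀ {h} → InCyclic G x h → ∃ λ m → h ≈ pow G x m
  InCyclic⇒pow (m , inj₁ h≈xᵐ)  = m , h≈xᵐ
  InCyclic⇒pow (m , inj₂ h≈x⁻ᵐ) = m ℕ.* ℕ.pred order , trans h≈x⁻ᵐ (pow-⁻¹ m)

module VertexBlocks {c ℓ} (G : Group c ℓ) (x : Group.Carrier G) where
  open Group G hiding (_-_)
  open GroupProperties G
  open GroupLemmas G

  InCyclic-resp-≈ : ∀ {a b} → a ≈ b → InCyclic G x a → InCyclic G x b
  InCyclic-resp-≈ a≈b (m , inj₁ a≈xᵐ)  = m , inj₁ (trans (sym a≈b) a≈xᵐ)
  InCyclic-resp-≈ a≈b (m , inj₂ a≈x⁻ᵐ) = m , inj₂ (trans (sym a≈b) a≈x⁻ᵐ)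

  subgroup⊇⟨x⟩⇒block : ∀ {H} → IsSubgroup H → (∀ m → H (pow G x m)) → IsBlock G x H
  subgroup⊇⟨x⟩⇒block {H} H-subgroup ⟨x⟩⊆H = vertexSet , block
    where
    open IsSubgroup H-subgroup

    cyclic⊆H : ∀ {h} → InCyclic G x h → H h
    cyclic⊆H (m , inj₁ h≈xᵐ)  = ∈-resp-≈ (sym h≈xᵐ) (⟨x⟩⊆H m)
    cyclic⊆H (m , inj₂ h≈x⁻ᵐ) = ∈-resp-≈ (sym h≈x⁻ᵐ) (⁻¹∈ (⟨x⟩⊆H m))

    vertexSet : IsVertexSet G x H
    vertexSet a b same a∈H = ∈-resp-≈ (\\-leftDividesˡ a b) (∙∈ a∈H (cyclic⊆H same))

    block : ∀ g → (∃ λ w → H (g ⁻¹ ∙ w) × H w) → ∀ w → H (g ⁻¹ ∙ w) ⇔ H w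
    block g (w , g⁻¹w∈H , w∈H) v =
      mk⇔ (λ g⁻¹v∈H → ∈-resp-≈ (\\-leftDividesˡ g v) (∙∈ g∈H g⁻¹v∈H)) (∙∈ g⁻¹∈H)
      where
      g⁻¹∈H : H (g ⁻¹)
      g⁻¹∈H = ∈-resp-≈ (//-rightDividesʳ w (g ⁻¹)) (∙∈ g⁻¹w∈H (⁻¹∈ w∈H))

      g∈H : H g
      g∈H = ∈-resp-≈ (⁻¹-involutive g) (⁻¹∈ g⁻¹∈H)

  primitive⇒⟨x⟩-maximal : PrimitiveOnVertices G x → ∀ {H} → IsSubgroup H →
    (∀ m → H (pow G x m)) → (∀ h → H h → InCyclic G x h) ⊎ (∀ h → H h)
  primitive⇒⟨x⟩-maximal (_ , blocks-trivial) H-subgroup ⟨x⟩⊆H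
    with blocks-trivial _ (subgroup⊇⟨x⟩⇒block H-subgroup ⟨x⟩⊆H)
  ... | inj₂ everything = inj₂ everything
  ... | inj₁ one-vertex = inj₁ λ h h∈H →
    InCyclic-resp-≈ (trans (∙-congʳ ε⁻¹≈ε) (identityˡ h)) (one-vertex ε h ε∈ h∈H)
    where open IsSubgroup H-subgroup

module Kernel {c ℓ} (G : Group c ℓ) (finite : FiniteGroup G) (x : Group.Carrier G) where
  open Group G hiding (_-_)
  open GroupProperties G
  open GroupLemmas G
  open Order G finite x
  open VertexBlocks G x
  open import Relation.Binary.Reasoning.Setoid setoid

  kernel⊆⟨x⟩ : ∀ {n} → InKernel G x n → ∃ λ m → n ≈ pow G x m
  kernel⊆⟨x⟩ {n} n∈N with InCyclic⇒pow (n∈N ε)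
  ... | m , [nε]⁻¹ε≈xᵐ = m ℕ.* ℕ.pred order , (begin
    n                        ≈⟨ ⁻¹-involutive n ⟨
    n ⁻¹ ⁻¹                  ≈⟨ ⁻¹-cong (⁻¹-cong (identityʳ n)) ⟨
    (n ∙ ε) ⁻¹ ⁻¹            ≈⟨ ⁻¹-cong (identityʳ _) ⟨
    ((n ∙ ε) ⁻¹ ∙ ε) ⁻¹      ≈⟨ ⁻¹-cong [nε]⁻¹ε≈xᵐ ⟩
    pow G x m ⁻¹             ≈⟨ pow-⁻¹ m ⟩
    pow G x (m ℕ.* ℕ.pred order) ∎)

  kernel-normal : ∀ {n} → InKernel G x n → ∀ g → InKernel G x (conj g n)
  kernel-normal {n} n∈N g h = InCyclic-resp-≈ same-element (n∈N (g ∙ h))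
    where
    same-element : (n ∙ (g ∙ h)) ⁻¹ ∙ (g ∙ h) ≈ (g ⁻¹ ∙ n ∙ g ∙ h) ⁻¹ ∙ h
    same-element = begin
      (n ∙ (g ∙ h)) ⁻¹ ∙ (g ∙ h)      ≈⟨ assoc _ g h ⟨
      (n ∙ (g ∙ h)) ⁻¹ ∙ g ∙ h        ≈⟨ ∙-congʳ (∙-congˡ (⁻¹-involutive g)) ⟨
      (n ∙ (g ∙ h)) ⁻¹ ∙ g ⁻¹ ⁻¹ ∙ h  ≈⟨ ∙-congʳ (⁻¹-anti-homo-∙ (g ⁻¹) (n ∙ (g ∙ h))) ⟨
      (g ⁻¹ ∙ (n ∙ (g ∙ h))) ⁻¹ ∙ h   ≈⟨ ∙-congʳ (⁻¹-cong reassociate) ⟩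
      (g ⁻¹ ∙ n ∙ g ∙ h) ⁻¹ ∙ h       ∎
      where
      reassociate : g ⁻¹ ∙ (n ∙ (g ∙ h)) ≈ g ⁻¹ ∙ n ∙ g ∙ h
      reassociate = solve monoid

  ⟨x⟩⊆centraliser : ∀ m → Centralises (InKernel G x) (pow G x m)
  ⟨x⟩⊆centraliser m n n∈N with kernel⊆⟨x⟩ n∈N
  ... | j , n≈xʲ = commute-respʳ-≈ (sym n≈xʲ) (pow-commute x m j)

  centraliser-normal : ∀ {a} → Centralises (InKernel G x) a → ∀ g →
    Centralises (InKernel G x) (conj g a)
  centraliser-normal a∈C g n n∈N =
    commute-respʳ-≈ (conj-conj⁻¹ g n) (conj-commute g (a∈C _ (kernel-normal n∈N (g ⁻¹))))

  x∈centraliser : Centralises (InKernel G x) x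
  x∈centraliser n n∈N = commute-respˡ-≈ (identityʳ x) (⟨x⟩⊆centraliser 1 n n∈N)

  ⟨x⟩-normal : PrimitiveOnVertices G x → ¬ (∀ n → InKernel G x n → InCentre G n) →
    ∀ g → ∃ λ u → conj g x ≈ pow G x u
  ⟨x⟩-normal prim N⊈Z g = [ x^g∈⟨x⟩ , C=G-absurd ]′
    (primitive⇒⟨x⟩-maximal prim (centraliser-isSubgroup (InKernel G x)) ⟨x⟩⊆centraliser)
    where
    x^g∈⟨x⟩ : (∀ h → Centralises (InKernel G x) h → InCyclic G x h) → ∃ λ u → conj g x ≈ pow G x u
    x^g∈⟨x⟩ C⊆⟨x⟩ = InCyclic⇒pow (C⊆⟨x⟩ (conj g x) (centraliser-normal x∈centraliser g))

    C=G-absurd : (∀ h → Centralises (InKernel G x) h) → ∃ λ u → conj g x ≈ pow G x u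
    C=G-absurd C=G = ⊥-elim (N⊈Z λ n n∈N h → sym (C=G h n n∈N))

module DipoleEquality (k : ℕ) (u : ℤ) where
  open Dipole k u

  ≈D-trans : ∀ {i j l s t r} → (i , s) ≈D (j , t) → (j , t) ≈D (l , r) → (i , s) ≈D (l , r)
  ≈D-trans {i} {j} {l} (≡.refl , k∣i-j) (≡.refl , k∣j-l) =
    ≡.refl , ∣-telescope {+ k} {i} {j} {l} k∣i-j k∣j-l

module DipoleStructure {c ℓ} (G : Group c ℓ) (finite : FiniteGroup G) {x y : Group.Carrier G}
  (generates : Generates G x y) (y²≈ε : Group._≈_ G (Group._∙_ G y y) (Group.ε G))
  (u : ℕ) (xʸ≈xᵘ : Group._≈_ G (GroupLemmas.conj G y x) (pow G x u))
  (y∉⟨x⟩ : ∀ m → ¬ Group._≈_ G y (pow G x m)) where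
  open Group G hiding (_-_)
  open GroupProperties G
  open GroupLemmas G
  open Order G finite x
  open Dipole order (+ u)
  open DipoleEquality order (+ u)
  open import Relation.Binary.Reasoning.Setoid setoid

  y⁻¹≈y : y ⁻¹ ≈ y
  y⁻¹≈y = sym (inverseʳ-unique y y y²≈ε)

  conj-pow : ∀ m → conj y (pow G x m) ≈ pow G x (m ℕ.* u)
  conj-pow zero    = conj-ε y
  conj-pow (suc m) = begin
    conj y (x ∙ pow G x m)             ≈⟨ conj-∙ y x _ ⟩
    conj y x ∙ conj y (pow G x m)      ≈⟨ ∙-cong xʸ≈xᵘ (conj-pow m) ⟩
    pow G x u ∙ pow G x (m ℕ.* u)      ≈⟨ pow-+ x u _ ⟨
    pow G x (u ℕ.+ m ℕ.* u)            ∎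

  yˢ : Bool → Carrier
  yˢ false = ε
  yˢ true  = y

  twist : Bool → ℕ → ℕ
  twist s b = if s then u ℕ.* b else b

  yˢ∙xᵇ : ∀ s b → yˢ s ∙ pow G x b ≈ pow G x (twist s b) ∙ yˢ s
  yˢ∙xᵇ false b = trans (identityˡ _) (sym (identityʳ _))
  yˢ∙xᵇ true  b = begin
    y ∙ pow G x b                 ≈⟨ ∙-congʳ y⁻¹≈y ⟨
    y ⁻¹ ∙ pow G x b              ≈⟨ ⁻¹∙≈conj∙⁻¹ y _ ⟩
    conj y (pow G x b) ∙ y ⁻¹     ≈⟨ ∙-cong (conj-pow b) y⁻¹≈y ⟩
    pow G x (b ℕ.* u) ∙ y         ≡⟨ ≡.cong (λ e → pow G x e ∙ y) (ℕ.*-comm b u) ⟩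
    pow G x (u ℕ.* b) ∙ y         ∎

  yˢ∙yᵗ : ∀ s t → yˢ s ∙ yˢ t ≈ yˢ (s xor t)
  yˢ∙yᵗ false t     = identityˡ _
  yˢ∙yᵗ true  false = identityʳ _
  yˢ∙yᵗ true  true  = y²≈ε

  yˢ-⁻¹ : ∀ s → yˢ s ⁻¹ ≈ yˢ s
  yˢ-⁻¹ false = ε⁻¹≈ε
  yˢ-⁻¹ true  = y⁻¹≈y

  NormalForm : Carrier → Set ℓ
  NormalForm g = ∃₂ λ a s → g ≈ pow G x a ∙ yˢ s

  normalForm-∙ : ∀ a s b t →
    (pow G x a ∙ yˢ s) ∙ (pow G x b ∙ yˢ t) ≈ pow G x (a ℕ.+ twist s b) ∙ yˢ (s xor t)
  normalForm-∙ a s b t = begin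
    (pow G x a ∙ yˢ s) ∙ (pow G x b ∙ yˢ t)           ≈⟨ solve monoid ⟩
    pow G x a ∙ (yˢ s ∙ pow G x b) ∙ yˢ t             ≈⟨ ∙-congʳ (∙-congˡ (yˢ∙xᵇ s b)) ⟩
    pow G x a ∙ (pow G x (twist s b) ∙ yˢ s) ∙ yˢ t   ≈⟨ solve monoid ⟩
    (pow G x a ∙ pow G x (twist s b)) ∙ (yˢ s ∙ yˢ t) ≈⟨ ∙-cong (sym (pow-+ x a _)) (yˢ∙yᵗ s t) ⟩
    pow G x (a ℕ.+ twist s b) ∙ yˢ (s xor t)          ∎

  normalForm-⁻¹ : ∀ a s → (pow G x a ∙ yˢ s) ⁻¹ ≈ pow G x (twist s (a ℕ.* ℕ.pred order)) ∙ yˢ s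
  normalForm-⁻¹ a s = begin
    (pow G x a ∙ yˢ s) ⁻¹                        ≈⟨ ⁻¹-anti-homo-∙ _ _ ⟩
    yˢ s ⁻¹ ∙ pow G x a ⁻¹                       ≈⟨ ∙-cong (yˢ-⁻¹ s) (pow-⁻¹ a) ⟩
    yˢ s ∙ pow G x (a ℕ.* ℕ.pred order)          ≈⟨ yˢ∙xᵇ s _ ⟩
    pow G x (twist s (a ℕ.* ℕ.pred order)) ∙ yˢ s ∎

  normalForm-isSubgroup : IsSubgroup NormalForm
  normalForm-isSubgroup = record
    { ∈-resp-≈ = λ { a≈b (e , s , a≈xᵉyˢ) → e , s , trans (sym a≈b) a≈xᵉyˢ }
    ; ε∈       = 0 , false , sym (identityʳ ε)
    ; ∙∈       = λ { (a , s , g≈xᵃyˢ) (b , t , h≈xᵇyᵗ) → a ℕ.+ twist s b , s xor t ,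
                     trans (∙-cong g≈xᵃyˢ h≈xᵇyᵗ) (normalForm-∙ a s b t) }
    ; ⁻¹∈      = λ { (a , s , g≈xᵃyˢ) → twist s (a ℕ.* ℕ.pred order) , s ,
                     trans (⁻¹-cong g≈xᵃyˢ) (normalForm-⁻¹ a s) }
    }

  normalForm : ∀ g → NormalForm g
  normalForm g = generated⊆subgroup normalForm-isSubgroup
    (1 , false , sym (trans (identityʳ _) (identityʳ x)))
    (0 , true , sym (identityˡ y))
    (generates g)

  xᵃ≉xᵇy : ∀ a b → ¬ pow G x a ∙ ε ≈ pow G x b ∙ y
  xᵃ≉xᵇy a b xᵃ≈xᵇy = y∉⟨x⟩ (b ℕ.* ℕ.pred order ℕ.+ a) (begin
    y                                            ≈⟨ \\-leftDividesʳ (pow G x b) y ⟨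
    pow G x b ⁻¹ ∙ (pow G x b ∙ y)               ≈⟨ ∙-congˡ xᵃ≈xᵇy ⟨
    pow G x b ⁻¹ ∙ (pow G x a ∙ ε)               ≈⟨ ∙-cong (pow-⁻¹ b) (identityʳ _) ⟩
    pow G x (b ℕ.* ℕ.pred order) ∙ pow G x a     ≈⟨ pow-+ x (b ℕ.* ℕ.pred order) a ⟨
    pow G x (b ℕ.* ℕ.pred order ℕ.+ a)           ∎)

  normalForm-unique : ∀ a s b t → pow G x a ∙ yˢ s ≈ pow G x b ∙ yˢ t → (+ a , s) ≈D (+ b , t)
  normalForm-unique a false b false e = ≡.refl , Equivalence.to (pow≈pow⇔∣ a b) (∙-cancelʳ ε _ _ e)
  normalForm-unique a true  b true  e = ≡.refl , Equivalence.to (pow≈pow⇔∣ a b) (∙-cancelʳ y _ _ e)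
  normalForm-unique a false b true  e = ⊥-elim (xᵃ≉xᵇy a b e)
  normalForm-unique a true  b false e = ⊥-elim (xᵃ≉xᵇy b a (sym e))

  φ : Carrier → Elt
  φ g = + proj₁ (normalForm g) , proj₁ (proj₂ (normalForm g))

  φ-normalForm : ∀ {g} a s → g ≈ pow G x a ∙ yˢ s → φ g ≈D (+ a , s)
  φ-normalForm {g} a s g≈xᵃyˢ with normalForm g
  ... | b , t , g≈xᵇyᵗ = normalForm-unique b t a s (trans (sym g≈xᵇyᵗ) g≈xᵃyˢ)

  +-twist : ∀ a s b → + (a ℕ.+ twist s b) ≡ + a ℤ.+ (if s then + u * + b else + b)
  +-twist a false b = ≡.refl
  +-twist a true  b = ≡.cong (λ e → + a ℤ.+ e) (ℤ.pos-* u b)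

  dipole-iso : IsoToDipole G x y order (+ u)
  dipole-iso = φ , φ-cong , φ-injective , φ-surjective , φ-homo ,
    φ-normalForm 1 false (sym (trans (identityʳ _) (identityʳ x))) ,
    φ-normalForm 0 true (sym (identityˡ y))
    where
    φ-cong : ∀ g h → g ≈ h → φ g ≈D φ h
    φ-cong g h g≈h with normalForm h
    ... | a , s , h≈xᵃyˢ = φ-normalForm a s (trans g≈h h≈xᵃyˢ)

    φ-injective : ∀ g h → φ g ≈D φ h → g ≈ h
    φ-injective g h with normalForm g | normalForm h
    ... | a , s , g≈xᵃyˢ | b , t , h≈xᵇyᵗ = λ { (≡.refl , order∣a-b) →
      trans g≈xᵃyˢ (trans (∙-congʳ (Equivalence.from (pow≈pow⇔∣ a b) order∣a-b)) (sym h≈xᵇyᵗ)) }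

    φ-surjective : ∀ e → ∃ λ g → φ g ≈D e
    φ-surjective (z , s) =
      g , ≈D-trans {proj₁ (φ g)} {+ r} {z} (φ-normalForm r s refl) (≡.refl , n∣[m%ℕn]-m z order)
      where
      r = z ℤ.%ℕ order
      g = pow G x r ∙ yˢ s

    φ-homo : ∀ g h → φ (g ∙ h) ≈D (φ g ·D φ h)
    φ-homo g h with normalForm g | normalForm h
    ... | a , s , g≈xᵃyˢ | b , t , h≈xᵇyᵗ =
      ≡.subst (λ e → φ (g ∙ h) ≈D (e , s xor t)) (+-twist a s b)
        (φ-normalForm (a ℕ.+ twist s b) (s xor t) (trans (∙-cong g≈xᵃyˢ h≈xᵇyᵗ) (normalForm-∙ a s b t)))

  order∣u²-1 : (+ order) ∣ (+ u * + u - + 1)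
  order∣u²-1 = ≡.subst (λ e → (+ order) ∣ (e - + 1)) (ℤ.pos-* u u)
    (Equivalence.to (pow≈pow⇔∣ (u ℕ.* u) 1) (begin
      pow G x (u ℕ.* u)                 ≈⟨ conj-pow u ⟨
      conj y (pow G x u)                ≈⟨ conj-cong refl xʸ≈xᵘ ⟨
      conj y (conj y x)                 ≈⟨ conj-cong refl (conj-cong (sym y⁻¹≈y) refl) ⟩
      conj y (conj (y ⁻¹) x)            ≈⟨ conj-conj⁻¹ y x ⟩
      x                                 ≈⟨ identityʳ x ⟨
      pow G x 1                         ∎))

  order∣u-1⇒commute : (+ order) ∣ (+ u - + 1) → Commute x y
  order∣u-1⇒commute order∣u-1 = conj-fixed⇒commute
    (trans xʸ≈xᵘ (trans (Equivalence.from (pow≈pow⇔∣ u 1) order∣u-1) (identityʳ x)))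

proposition5p2 : ∀ {c ℓ : Level} (G : Group c ℓ) (x y : Group.Carrier G) →
    FiniteGroup G →
    Generates G x y →
    Group._≈_ G (Group._∙_ G y y) (Group.ε G) →
    PrimitiveOnVertices G x →
    ¬ (∀ g → InKernel G x g → InCentre G g) →
    ∃ λ (k : ℕ) → ∃ λ (u : ℤ) →
      (k ≥ 1) × ((+ k) ∣ (u * u - + 1)) × ¬ ((+ k) ∣ (u - + 1)) ×
      IsoToDipole G x y k u
proposition5p2 G x y finite generates y²≈ε prim N⊈Z =
  order , + u , s≤s z≤n , order∣u²-1 , noncommutative ∘ order∣u-1⇒commute , dipole-iso
  where
  open Group G hiding (_-_)
  open GroupLemmas G

  noncommutative : ¬ Commute x y
  noncommutative xy = N⊈Z λ n _ → commuting-generators⇒commutative generates xy n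

  y∉⟨x⟩ : ∀ m → ¬ y ≈ pow G x m
  y∉⟨x⟩ m y≈xᵐ = noncommutative
    (commute-respˡ-≈ (identityʳ x) (commute-respʳ-≈ (sym y≈xᵐ) (pow-commute x 1 m)))

  xʸ∈⟨x⟩ : ∃ λ u → conj y x ≈ pow G x u
  xʸ∈⟨x⟩ = Kernel.⟨x⟩-normal G finite x prim N⊈Z y

  u : ℕ
  u = proj₁ xʸ∈⟨x⟩

  open Order G finite x using (order)
  open DipoleStructure G finite generates y²≈ε u (proj₂ xʸ∈⟨x⟩) y∉⟨x⟩
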